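{- There exists an algorithm that, given $n,k$ and oracle access to an unknown multi-dimensional herringbone function $h^{\mathbf{s},j}:\{0,\ldots,n-1\}^k\to\{0,\ldots,n-1\}^k$ (the spine $\mathbf{s}$ and index $j$ being unknown), finds its fixed point using $O(k\log(n)\log(nk))$ queries.
   Context: Order $\{0,\ldots,n-1\}^k$ componentwise: $a\le b$ iff $a_i\le b_i$ for all $i$; $a<b$ means $a\le b$ and $a\ne b$. A spine is a sequence $\mathbf{s}=(s^0,\ldots,s^{(n-1)k})$ of vertices of $\{0,\ldots,n-1\}^k$ with $s^0=(0,\ldots,0)$, $s^{(n-1)k}=(n-1,\ldots,n-1)$ and $s^{i+1}>s^i$ for all $i$. For a spine $\mathbf{s}$ and $j\in\{0,\ldots,(n-1)k\}$ define $M(v)=\min\{i: s^i\ge v\}$ and $\mu(v)=\max\{i: s^i\le v\}$, and the multi-dimensional herringbone function $h^{\mathbf{s},j}(v)=v$ if $v=s^j$; $=s^{i+1}$ if $v=s^i$ with $i<j$; $=s^{i-1}$ if $v=s^i$ with $i>j$; and $=v+(s^{\mu(v)+1}-s^{\mu(v)})-(s^{M(v)}-s^{M(v)-1})$ otherwise. A query at $v$ returns $h^{\mathbf{s},j}(v)$. -}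

module Defs where

open import Data.Nat using (ℕ; zero; suc; _+_; _*_; _∸_; _≤_; _<_; _<?_)
open import Data.Nat.Properties using (≤-refl)
import Data.Nat.Properties as ℕP
open import Data.Integer as ℤ using (ℤ)
open import Data.Fin using (Fin; toℕ)
open import Data.Vec using (Vec; replicate; map; zipWith)
open import Data.Vec.Properties using (≡-dec)
open import Data.Vec.Relation.Binary.Pointwise.Inductive as PW using (Pointwise)
open import Data.Bool using (Bool; true; false; if_then_else_)
open import Data.Maybe using (Maybe; just; nothing)
open import Data.Product using (_×_; _,_)
open import Relation.Binary.PropositionalEquality using (_≡_; _≢_)
open import Relation.Nullary.Decidable using (⌊_⌋)
open import Relation.Nullary using (yes; no)

_≤ᵛ_ : ∀ {k} → Vec ℕ k → Vec ℕ k → Set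
a ≤ᵛ b = Pointwise _≤_ a b

_<ᵛ_ : ∀ {k} → Vec ℕ k → Vec ℕ k → Set
a <ᵛ b = (a ≤ᵛ b) × (a ≢ b)

_≤ᵛᵇ_ : ∀ {k} → Vec ℕ k → Vec ℕ k → Bool
a ≤ᵛᵇ b = ⌊ PW.decidable ℕP._≤?_ a b ⌋

_≡ᵛᵇ_ : ∀ {k} → Vec ℕ k → Vec ℕ k → Bool
a ≡ᵛᵇ b = ⌊ ≡-dec ℕP._≟_ a b ⌋

spineLen : ℕ → ℕ → ℕ
spineLen n k = (n ∸ 1) * k

-- A spine s = (s^0, …, s^{(n-1)k}). It is given as a function on ℕ;
-- only the values at indices 0 … (n-1)k are constrained and ever used.
record Spine (n k : ℕ) : Set where
  field
    pt    : ℕ → Vec ℕ k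
    start : pt 0 ≡ replicate k 0
    end   : pt (spineLen n k) ≡ replicate k (n ∸ 1)
    incr  : ∀ i → i < spineLen n k → pt i <ᵛ pt (suc i)
open Spine public

firstBelow : (ℕ → Bool) → ℕ → Maybe ℕ
firstBelow p zero = nothing
firstBelow p (suc m) with firstBelow p m
... | just i  = just i
... | nothing = if p m then just m else nothing

lastBelow : (ℕ → Bool) → ℕ → Maybe ℕ
lastBelow p zero = nothing
lastBelow p (suc m) = if p m then just m else lastBelow p m

fromMaybe : ℕ → Maybe ℕ → ℕ
fromMaybe d (just x) = x
fromMaybe d nothing  = d

module _ {n k : ℕ} (S : Spine n k) where
  private
    L = spineLen n k
    s = pt S

  -- M(v) = min { i : s^i ≥ v }   (always exists since s^L is the top)
  M : Vec ℕ k → ℕ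
  M v = fromMaybe L (firstBelow (λ i → v ≤ᵛᵇ s i) (suc L))

  -- μ(v) = max { i : s^i ≤ v }   (always exists since s^0 is the bottom)
  μ : Vec ℕ k → ℕ
  μ v = fromMaybe 0 (lastBelow (λ i → s i ≤ᵛᵇ v) (suc L))

  spineIndex : Vec ℕ k → Maybe ℕ
  spineIndex v = firstBelow (λ i → s i ≡ᵛᵇ v) (suc L)

  toℤᵛ : Vec ℕ k → Vec ℤ k
  toℤᵛ = map (λ x → ℤ.+ x)

  _+ᶻ_ _-ᶻ_ : Vec ℤ k → Vec ℤ k → Vec ℤ k
  _+ᶻ_ = zipWith ℤ._+_
  _-ᶻ_ = zipWith ℤ._-_

  -- The multi-dimensional herringbone function h^{s,j}, evaluated on a
  -- grid vertex v; values are computed in ℤ^k (no truncation).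
  herringbone : ℕ → Vec ℕ k → Vec ℤ k
  herringbone j v with spineIndex v
  ... | just i with i <? j | j <? i
  ...   | yes _ | _     = toℤᵛ (s (suc i))
  ...   | no _  | yes _ = toℤᵛ (s (i ∸ 1))
  ...   | no _  | no _  = toℤᵛ v
  herringbone j v | nothing =
    ((toℤᵛ v +ᶻ (toℤᵛ (s (suc (μ v))) -ᶻ toℤᵛ (s (μ v))))
      -ᶻ (toℤᵛ (s (M v)) -ᶻ toℤᵛ (s (M v ∸ 1))))

Point : ℕ → ℕ → Set
Point n k = Vec (Fin n) k

coords : ∀ {n k} → Point n k → Vec ℕ k
coords = map toℕ

data QueryAlg (n k : ℕ) : Set where
  output : Point n k → QueryAlg n k
  query  : Point n k → (Vec ℤ k → QueryAlg n k) → QueryAlg n k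

run : ∀ {n k} → QueryAlg n k → (Vec ℕ k → Vec ℤ k) → Point n k × ℕ
run (output p)  f = p , 0
run (query p c) f with run (c (f (coords p))) f
... | r , q = r , suc q

module Submission where

-- A spine has exactly one vertex s^i on each level i, where the level of a vertex is its coordinate sum,
-- and the fixed point s^j lies on level j. A query at a vertex v of level ℓ reveals, by the level of the
-- answer, whether j lies above or below ℓ; if the answer stays on level ℓ and differs from v, then in
-- every coordinate where it moves up (down) the spine vertex s^ℓ lies strictly above (below) v, because
-- off the spine the answer is v plus the unit step leaving the last spine vertex below v minus the unit
-- step entering the first spine vertex above v. So j is found by binary search over the O(log nk) levels,
-- and on each level a box around s^ℓ is shrunk by querying a vertex of level ℓ that splits every side
-- length so that all lower parts or all upper parts are at most half: since the answer moves some
-- coordinate up and some down, some side at least halves, which bounds the queries per level by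
-- k⌈log₂ n⌉ + 1 through the potential Σ_c ⌈log₂ (side length of c)⌉.

open import Defs
open import Data.Empty using (⊥; ⊥-elim)
open import Data.Fin using (toℕ) renaming (zero to fzero; suc to fsuc)
import Data.Fin.Properties as Finₚ
open import Data.Integer as ℤ using (ℤ)
import Data.Integer.Properties as ℤₚ
open import Data.Integer.Tactic.RingSolver using (solve-∀)
open import Data.Maybe using (just; nothing)
open import Data.Nat using (ℕ; zero; suc; _+_; _*_; _∸_; _≤_; _<_; z≤n; s≤s; z<s; >-nonZero; _⊓_; ⌊_/2⌋; ⌈_/2⌉)
open import Data.Nat.DivMod using (_mod_; m<n⇒m%n≡m)
open import Data.Nat.Logarithm using (⌈log₂_⌉; ⌈log₂⌉-mono-≤; ⌈log₂2*n⌉≡1+⌈log₂n⌉; ⌈log₂2^n⌉≡n)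
open import Data.Nat.Properties
import Data.Nat.Tactic.RingSolver as ℕ-Solver
open import Data.Product using (Σ; ∃-syntax; _×_; _,_; proj₁; proj₂)
import Data.Product as Prod
open import Data.Sum using (_⊎_; inj₁; inj₂; [_,_]′)
open import Data.Vec using (Vec; []; _∷_; lookup; sum; map; zipWith; replicate; tabulate)
import Data.Vec.Properties as Vecₚ
import Data.Vec.Relation.Binary.Pointwise.Inductive as Pointwise
open import Data.Vec.Relation.Binary.Pointwise.Extensional using (ext; extensional⇒inductive)
open import Function using (_∘_)
open import Relation.Binary.Definitions using (tri<; tri≈; tri>)
open import Relation.Binary.PropositionalEquality
  using (_≡_; _≢_; refl; sym; trans; cong; cong₂; subst; subst₂; module ≡-Reasoning)
open import Relation.Nullary using (¬_; yes; no; contradiction)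
open import Relation.Nullary.Decidable using (⌊_⌋)
import Relation.Unary as U
open import Algebra.Properties.AbelianGroup ℤₚ.+-0-abelianGroup
  using () renaming (∙-cancelˡ to +-cancelˡ-ℤ; ∙-cancelʳ to +-cancelʳ-ℤ)
open import Algebra.Properties.CommutativeSemigroup ℤₚ.+-commutativeSemigroup
  using () renaming (interchange to ℤ-interchange)
open import Algebra.Properties.CommutativeSemigroup +-commutativeSemigroup
  using () renaming (interchange to +-interchange)

-- Componentwise order and coordinate sums

≤ᵛ-refl : ∀ {k} {a : Vec ℕ k} → a ≤ᵛ a
≤ᵛ-refl = Pointwise.refl ≤-refl

≤ᵛ-trans : ∀ {k} {a b c : Vec ℕ k} → a ≤ᵛ b → b ≤ᵛ c → a ≤ᵛ c
≤ᵛ-trans = Pointwise.trans ≤-trans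

≤ᵛ-lookup : ∀ {k} {a b : Vec ℕ k} → a ≤ᵛ b → ∀ i → lookup a i ≤ lookup b i
≤ᵛ-lookup = Pointwise.lookup

lookup⇒≤ᵛ : ∀ {k} {a b : Vec ℕ k} → (∀ i → lookup a i ≤ lookup b i) → a ≤ᵛ b
lookup⇒≤ᵛ a≤b = extensional⇒inductive (ext a≤b)

sum-mono-≤ᵛ : ∀ {k} {a b : Vec ℕ k} → a ≤ᵛ b → sum a ≤ sum b
sum-mono-≤ᵛ Pointwise.[]         = z≤n
sum-mono-≤ᵛ (x≤y Pointwise.∷ a≤b) = +-mono-≤ x≤y (sum-mono-≤ᵛ a≤b)

≤ᵛ∧sum≤⇒≡ : ∀ {k} {a b : Vec ℕ k} → a ≤ᵛ b → sum b ≤ sum a → a ≡ b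
≤ᵛ∧sum≤⇒≡ Pointwise.[] _ = refl
≤ᵛ∧sum≤⇒≡ {a = x ∷ a} {y ∷ b} (x≤y Pointwise.∷ a≤b) Σb≤Σa =
  cong₂ _∷_ x≡y (≤ᵛ∧sum≤⇒≡ a≤b (+-cancelˡ-≤ y _ _ (subst (λ z → y + sum b ≤ z + sum a) x≡y Σb≤Σa)))
  where
  x≡y : x ≡ y
  x≡y = ≤-antisym x≤y (+-cancelʳ-≤ (sum b) y x
          (≤-trans Σb≤Σa (+-monoʳ-≤ x (sum-mono-≤ᵛ a≤b))))

<ᵛ⇒sum< : ∀ {k} {a b : Vec ℕ k} → a <ᵛ b → sum a < sum b
<ᵛ⇒sum< (a≤b , a≢b) = ≰⇒> (a≢b ∘ ≤ᵛ∧sum≤⇒≡ a≤b)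

lookup≤sum : ∀ {k} (w : Vec ℕ k) i → lookup w i ≤ sum w
lookup≤sum (x ∷ w) fzero    = m≤m+n x (sum w)
lookup≤sum (x ∷ w) (fsuc i) = ≤-trans (lookup≤sum w i) (m≤n+m (sum w) x)

lookup+lookup≤sum : ∀ {k} (w : Vec ℕ k) {i i'} → i ≢ i' → lookup w i + lookup w i' ≤ sum w
lookup+lookup≤sum (x ∷ w) {fzero}  {fzero}   i≢i' = contradiction refl i≢i'
lookup+lookup≤sum (x ∷ w) {fzero}  {fsuc i'} _    = +-monoʳ-≤ x (lookup≤sum w i')
lookup+lookup≤sum (x ∷ w) {fsuc i} {fzero}   _    = subst (_≤ x + sum w) (+-comm x _) (+-monoʳ-≤ x (lookup≤sum w i))
lookup+lookup≤sum (x ∷ w) {fsuc i} {fsuc i'} i≢i' =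
  ≤-trans (lookup+lookup≤sum w (i≢i' ∘ cong fsuc)) (m≤n+m (sum w) x)

sum-∸ᵛ : ∀ {k} {a b : Vec ℕ k} → a ≤ᵛ b → sum (zipWith _∸_ b a) + sum a ≡ sum b
sum-∸ᵛ Pointwise.[] = refl
sum-∸ᵛ {a = x ∷ a} {y ∷ b} (x≤y Pointwise.∷ a≤b) =
  trans (+-interchange (y ∸ x) _ x (sum a)) (cong₂ _+_ (m∸n+n≡m x≤y) (sum-∸ᵛ a≤b))

≤ᵛ-unit-step : ∀ {k} {a b : Vec ℕ k} → a ≤ᵛ b → sum b ≤ suc (sum a) →
               ∀ {i} → lookup a i < lookup b i → ∀ {i'} → i' ≢ i → lookup a i' ≡ lookup b i'
≤ᵛ-unit-step {k} {a} {b} a≤b Σb≤1+Σa {i} aᵢ<bᵢ {i'} i'≢i =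
  ≤-antisym (≤ᵛ-lookup a≤b i') (≮⇒≥ λ aᵢ'<bᵢ' → <⇒≱ (two≤gaps aᵢ'<bᵢ') Σb≤1+Σa)
  where
  gaps : Vec ℕ k
  gaps = zipWith _∸_ b a
  gap-lookup : ∀ c → lookup a c < lookup b c → 1 ≤ lookup gaps c
  gap-lookup c lt = subst (1 ≤_) (sym (Vecₚ.lookup-zipWith _∸_ c b a)) (m<n⇒0<n∸m lt)
  two≤gaps : lookup a i' < lookup b i' → suc (suc (sum a)) ≤ sum b
  two≤gaps lt = subst (suc (suc (sum a)) ≤_) (sum-∸ᵛ a≤b)
    (+-monoˡ-≤ (sum a) (≤-trans (+-mono-≤ (gap-lookup i' lt) (gap-lookup i aᵢ<bᵢ)) (lookup+lookup≤sum gaps i'≢i)))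

≤ᵛ-except : ∀ {k} {a b : Vec ℕ k} c → lookup a c ≤ lookup b c →
            (∀ {c'} → c' ≢ c → lookup a c' ≤ lookup b c') → a ≤ᵛ b
≤ᵛ-except {a = a} {b} c ac≤bc others = lookup⇒≤ᵛ case-c'
  where
  case-c' : ∀ c' → lookup a c' ≤ lookup b c'
  case-c' c' with c' Finₚ.≟ c
  ... | yes refl = ac≤bc
  ... | no c'≢c  = others c'≢c

sum-zipWith-+ : ∀ {k} (a b : Vec ℕ k) → sum (zipWith _+_ a b) ≡ sum a + sum b
sum-zipWith-+ []      []      = refl
sum-zipWith-+ (x ∷ a) (y ∷ b) = trans (cong (x + y +_) (sum-zipWith-+ a b)) (+-interchange x y (sum a) (sum b))

sum-replicate : ∀ k x → sum (replicate k x) ≡ k * x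
sum-replicate zero    x = refl
sum-replicate (suc k) x = cong (x +_) (sum-replicate k x)

replicate-0-≤ᵛ : ∀ {k} (v : Vec ℕ k) → replicate k 0 ≤ᵛ v
replicate-0-≤ᵛ []      = Pointwise.[]
replicate-0-≤ᵛ (x ∷ v) = z≤n Pointwise.∷ replicate-0-≤ᵛ v

toℤ : ∀ {k} → Vec ℕ k → Vec ℤ k
toℤ = map (λ x → ℤ.+ x)

sumℤ : ∀ {k} → Vec ℤ k → ℤ
sumℤ []       = ℤ.+ 0
sumℤ (x ∷ xs) = x ℤ.+ sumℤ xs

sumℤ-toℤ : ∀ {k} (v : Vec ℕ k) → sumℤ (toℤ v) ≡ ℤ.+ sum v
sumℤ-toℤ []      = refl
sumℤ-toℤ (x ∷ v) = trans (cong (λ z → ℤ.+ x ℤ.+ z) (sumℤ-toℤ v)) (sym (ℤₚ.pos-+ x (sum v)))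

sumℤ-zipWith-+ : ∀ {k} (a b : Vec ℤ k) → sumℤ (zipWith ℤ._+_ a b) ≡ sumℤ a ℤ.+ sumℤ b
sumℤ-zipWith-+ []      []      = refl
sumℤ-zipWith-+ (x ∷ a) (y ∷ b) =
  trans (cong (λ z → x ℤ.+ y ℤ.+ z) (sumℤ-zipWith-+ a b)) (ℤ-interchange x y (sumℤ a) (sumℤ b))

sumℤ-zipWith-- : ∀ {k} (a b : Vec ℤ k) → sumℤ (zipWith ℤ._-_ a b) ≡ sumℤ a ℤ.- sumℤ b
sumℤ-zipWith-- []      []      = refl
sumℤ-zipWith-- (x ∷ a) (y ∷ b) =
  trans (cong (λ z → x ℤ.- y ℤ.+ z) (sumℤ-zipWith-- a b))
        (trans (ℤ-interchange x (ℤ.- y) (sumℤ a) (ℤ.- sumℤ b))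
               (cong (λ z → x ℤ.+ sumℤ a ℤ.+ z) (sym (ℤₚ.neg-distrib-+ y (sumℤ b)))))

sumℤ-mono-≤ : ∀ {k} {a b : Vec ℤ k} → Pointwise.Pointwise ℤ._≤_ a b → sumℤ a ℤ.≤ sumℤ b
sumℤ-mono-≤ Pointwise.[]          = ℤₚ.≤-refl
sumℤ-mono-≤ (x≤y Pointwise.∷ a≤b) = ℤₚ.+-mono-≤ x≤y (sumℤ-mono-≤ a≤b)

≤∧sumℤ≡⇒≡ : ∀ {k} {a b : Vec ℤ k} → Pointwise.Pointwise ℤ._≤_ a b → sumℤ a ≡ sumℤ b → a ≡ b
≤∧sumℤ≡⇒≡ Pointwise.[] _ = refl
≤∧sumℤ≡⇒≡ {a = x ∷ a} {y ∷ b} (x≤y Pointwise.∷ a≤b) Σa≡Σb with x ℤₚ.≟ y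
... | yes refl = cong (x ∷_) (≤∧sumℤ≡⇒≡ a≤b (+-cancelˡ-ℤ x _ _ Σa≡Σb))
... | no x≢y   = contradiction Σa≡Σb (ℤₚ.<⇒≢ (ℤₚ.+-mono-<-≤ (ℤₚ.≤∧≢⇒< x≤y x≢y) (sumℤ-mono-≤ a≤b)))

sumℤ≡∧≢⇒∃< : ∀ {k} {a b : Vec ℤ k} → sumℤ a ≡ sumℤ b → a ≢ b → ∃[ c ] lookup a c ℤ.< lookup b c
sumℤ≡∧≢⇒∃< {k} {a} {b} Σa≡Σb a≢b
  with c , bc≰ac ← Finₚ.¬∀⟶∃¬ k (λ c → lookup b c ℤ.≤ lookup a c) (λ c → lookup b c ℤₚ.≤? lookup a c)
                     (λ b≤a → a≢b (sym (≤∧sumℤ≡⇒≡ (extensional⇒inductive (ext b≤a)) (sym Σa≡Σb))))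
  = c , ℤₚ.≰⇒> bc≰ac

module _ {p} {P : ℕ → Set p} (P? : U.Decidable P) where

  firstBelow-just : ∀ m {i} → firstBelow (λ x → ⌊ P? x ⌋) m ≡ just i →
                    i < m × P i × (∀ {i'} → i' < i → ¬ P i')
  firstBelow-nothing : ∀ m → firstBelow (λ x → ⌊ P? x ⌋) m ≡ nothing → ∀ {i} → i < m → ¬ P i

  firstBelow-just (suc m) e with firstBelow (λ x → ⌊ P? x ⌋) m in e'
  firstBelow-just (suc m) refl | just _ with i<m , Pi , least ← firstBelow-just m e' =
    m≤n⇒m≤1+n i<m , Pi , least
  firstBelow-just (suc m) e    | nothing with P? m
  firstBelow-just (suc m) refl | nothing | yes Pm = ≤-refl , Pm , firstBelow-nothing m e'

  firstBelow-nothing (suc m) e i<1+m with firstBelow (λ x → ⌊ P? x ⌋) m in e'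
  firstBelow-nothing (suc m) e i<1+m | nothing with P? m | m≤n⇒m<n∨m≡n (≤-pred i<1+m)
  ... | no ¬Pm | inj₁ i<m  = firstBelow-nothing m e' i<m
  ... | no ¬Pm | inj₂ refl = ¬Pm

  lastBelow-just : ∀ m {i} → lastBelow (λ x → ⌊ P? x ⌋) m ≡ just i →
                   i < m × P i × (∀ {i'} → i < i' → i' < m → ¬ P i')
  lastBelow-just (suc m) e with P? m
  lastBelow-just (suc m) refl | yes Pm = ≤-refl , Pm , λ i<i' i'<1+m → contradiction (≤-pred i'<1+m) (<⇒≱ i<i')
  lastBelow-just (suc m) e    | no ¬Pm with i<m , Pi , greatest ← lastBelow-just m e =
    m≤n⇒m≤1+n i<m , Pi ,
    λ i<i' i'<1+m → [ greatest i<i' , (λ { refl → ¬Pm }) ]′ (m≤n⇒m<n∨m≡n (≤-pred i'<1+m))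

  lastBelow-nothing : ∀ m → lastBelow (λ x → ⌊ P? x ⌋) m ≡ nothing → ∀ {i} → i < m → ¬ P i
  lastBelow-nothing (suc m) e i<1+m with P? m | m≤n⇒m<n∨m≡n (≤-pred i<1+m)
  ... | no ¬Pm | inj₁ i<m  = lastBelow-nothing m e i<m
  ... | no ¬Pm | inj₂ refl = ¬Pm

  least≤ : ℕ → ℕ
  least≤ m = fromMaybe m (firstBelow (λ x → ⌊ P? x ⌋) (suc m))

  greatest≤ : ℕ → ℕ
  greatest≤ m = fromMaybe 0 (lastBelow (λ x → ⌊ P? x ⌋) (suc m))

  record IsLeast≤ (m i : ℕ) : Set p where
    field
      bound : i ≤ m
      holds : P i
      least : ∀ {i'} → i' < i → ¬ P i'

  record IsGreatest≤ (m i : ℕ) : Set p where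
    field
      bound    : i ≤ m
      holds    : P i
      greatest : ∀ {i'} → i < i' → i' ≤ m → ¬ P i'

  least≤-spec : ∀ {m} → P m → IsLeast≤ m (least≤ m)
  least≤-spec {m} Pm with firstBelow (λ x → ⌊ P? x ⌋) (suc m) in e
  ... | just i  with i<1+m , Pi , least ← firstBelow-just (suc m) e =
    record { bound = ≤-pred i<1+m ; holds = Pi ; least = least }
  ... | nothing = contradiction Pm (firstBelow-nothing (suc m) e ≤-refl)

  greatest≤-spec : ∀ {m} → P 0 → IsGreatest≤ m (greatest≤ m)
  greatest≤-spec {m} P0 with lastBelow (λ x → ⌊ P? x ⌋) (suc m) in e
  ... | just i  with i<1+m , Pi , greatest ← lastBelow-just (suc m) e =
    record { bound = ≤-pred i<1+m ; holds = Pi ; greatest = λ i<i' i'≤m → greatest i<i' (s≤s i'≤m) }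
  ... | nothing = contradiction P0 (lastBelow-nothing (suc m) e (s≤s z≤n))

-- Spines

module _ {f : ℕ → ℕ} {L : ℕ} (increasing : ∀ i → i < L → f i < f (suc i)) where

  increasing-gap : ∀ i d → i + d ≤ L → f i + d ≤ f (i + d)
  increasing-gap i zero    _   = ≤-reflexive (trans (+-identityʳ (f i)) (cong f (sym (+-identityʳ i))))
  increasing-gap i (suc d) i+d<L = begin
    f i + suc d        ≡⟨ +-suc (f i) d ⟩
    suc (f i + d)      ≤⟨ s≤s (increasing-gap i d (<⇒≤ i+d<L')) ⟩
    suc (f (i + d))    ≤⟨ increasing (i + d) i+d<L' ⟩
    f (suc (i + d))    ≡⟨ cong f (+-suc i d) ⟨
    f (i + suc d)      ∎
    where
    open ≤-Reasoning
    i+d<L' : i + d < L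
    i+d<L' = subst (_≤ L) (+-suc i d) i+d<L

  increasing-pinned : f 0 ≡ 0 → f L ≡ L → ∀ {i} → i ≤ L → f i ≡ i
  increasing-pinned f0≡0 fL≡L {i} i≤L = ≤-antisym fi≤i i≤fi
    where
    i≤fi : i ≤ f i
    i≤fi = subst (_≤ f i) (cong (_+ i) f0≡0) (increasing-gap 0 i i≤L)
    fi≤i : f i ≤ i
    fi≤i = +-cancelʳ-≤ (L ∸ i) (f i) i (begin
      f i + (L ∸ i)  ≤⟨ increasing-gap i (L ∸ i) (≤-reflexive (m+[n∸m]≡n i≤L)) ⟩
      f (i + (L ∸ i)) ≡⟨ cong f (m+[n∸m]≡n i≤L) ⟩
      f L            ≡⟨ fL≡L ⟩
      L              ≡⟨ m+[n∸m]≡n i≤L ⟨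
      i + (L ∸ i)    ∎)
      where open ≤-Reasoning

module SpineProperties {n k : ℕ} (S : Spine n k) where

  private
    L : ℕ
    L = spineLen n k
    s : ℕ → Vec ℕ k
    s = pt S

  sum-top : sum (replicate k (n ∸ 1)) ≡ L
  sum-top = trans (sum-replicate k (n ∸ 1)) (*-comm k (n ∸ 1))

  sum-≤-top : ∀ {v} → v ≤ᵛ replicate k (n ∸ 1) → sum v ≤ L
  sum-≤-top v≤top = subst (_ ≤_) sum-top (sum-mono-≤ᵛ v≤top)

  sum-pt : ∀ {i} → i ≤ L → sum (s i) ≡ i
  sum-pt = increasing-pinned (λ i i<L → <ᵛ⇒sum< (incr S i i<L))
             (trans (cong sum (start S)) (trans (sum-replicate k 0) (*-zeroʳ k)))
             (trans (cong sum (end S)) sum-top)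

  pt-mono : ∀ {i i'} → i ≤ i' → i' ≤ L → s i ≤ᵛ s i'
  pt-mono {i} {i'} i≤i' i'≤L with d , refl ← m≤n⇒∃[o]m+o≡n i≤i' = climb d i'≤L
    where
    climb : ∀ d → i + d ≤ L → s i ≤ᵛ s (i + d)
    climb zero    _     = subst (λ z → s i ≤ᵛ s z) (sym (+-identityʳ i)) ≤ᵛ-refl
    climb (suc d) i+d<L = subst (λ z → s i ≤ᵛ s z) (sym (+-suc i d))
      (≤ᵛ-trans (climb d (<⇒≤ i+d<L')) (proj₁ (incr S (i + d) i+d<L')))
      where
      i+d<L' : i + d < L
      i+d<L' = subst (_≤ L) (+-suc i d) i+d<L

  pt-≤-top : ∀ {i} → i ≤ L → s i ≤ᵛ replicate k (n ∸ 1)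
  pt-≤-top i≤L = subst (s _ ≤ᵛ_) (end S) (pt-mono i≤L ≤-refl)

  pt-injective : ∀ {i i'} → i ≤ L → i' ≤ L → s i ≡ s i' → i ≡ i'
  pt-injective i≤L i'≤L si≡si' = trans (sym (sum-pt i≤L)) (trans (cong sum si≡si') (sum-pt i'≤L))

  pt-unit-step : ∀ {i} → i < L → ∀ {c} → lookup (s i) c < lookup (s (suc i)) c →
                 ∀ {c'} → c' ≢ c → lookup (s i) c' ≡ lookup (s (suc i)) c'
  pt-unit-step {i} i<L = ≤ᵛ-unit-step (proj₁ (incr S i i<L))
    (≤-reflexive (trans (sum-pt i<L) (cong suc (sym (sum-pt (<⇒≤ i<L))))))

-- What a query reveals

shifted : ℕ → ℕ → ℕ → ℕ → ℕ → ℤ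
shifted v q p r r' = (ℤ.+ v ℤ.+ (ℤ.+ q ℤ.- ℤ.+ p)) ℤ.- (ℤ.+ r ℤ.- ℤ.+ r')

-- Adding p + r to a shifted coordinate removes every subtraction, so comparisons move to ℕ.
shifted-+ : ∀ v q p r r' → shifted v q p r r' ℤ.+ ℤ.+ (p + r) ≡ ℤ.+ (v + q + r')
shifted-+ v q p r r' = begin
  shifted v q p r r' ℤ.+ ℤ.+ (p + r)        ≡⟨ cong (λ z → shifted v q p r r' ℤ.+ z) (ℤₚ.pos-+ p r) ⟩
  shifted v q p r r' ℤ.+ (ℤ.+ p ℤ.+ ℤ.+ r)  ≡⟨ cancel (ℤ.+ v) (ℤ.+ q) (ℤ.+ p) (ℤ.+ r) (ℤ.+ r') ⟩
  ℤ.+ v ℤ.+ ℤ.+ q ℤ.+ ℤ.+ r'                ≡⟨ cong (λ z → z ℤ.+ ℤ.+ r') (ℤₚ.pos-+ v q) ⟨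
  ℤ.+ (v + q) ℤ.+ ℤ.+ r'                    ≡⟨ ℤₚ.pos-+ (v + q) r' ⟨
  ℤ.+ (v + q + r')                          ∎
  where
  open ≡-Reasoning
  cancel : ∀ a b c d e → (a ℤ.+ (b ℤ.- c)) ℤ.- (d ℤ.- e) ℤ.+ (c ℤ.+ d) ≡ a ℤ.+ b ℤ.+ e
  cancel = solve-∀

shifted-unit : ∀ v p r' → shifted v (suc p) p (suc r') r' ≡ ℤ.+ v
shifted-unit v p r' = +-cancelʳ-ℤ (ℤ.+ (p + suc r')) _ _ (begin
  shifted v (suc p) p (suc r') r' ℤ.+ ℤ.+ (p + suc r') ≡⟨ shifted-+ v (suc p) p (suc r') r' ⟩
  ℤ.+ (v + suc p + r')                                ≡⟨ cong ℤ.+_ (trans (+-assoc v (suc p) r')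
                                                                         (cong (v +_) (sym (+-suc p r')))) ⟩
  ℤ.+ (v + (p + suc r'))                              ≡⟨ ℤₚ.pos-+ v (p + suc r') ⟩
  ℤ.+ v ℤ.+ ℤ.+ (p + suc r')                          ∎)
  where open ≡-Reasoning

shifted-<⇒< : ∀ v q p r r' → ℤ.+ v ℤ.< shifted v q p r r' → r' ≤ r → p < q
shifted-<⇒< v q p r r' v<shifted r'≤r = ≰⇒> λ q≤p → <⇒≱ p+r<q+r' (+-mono-≤ q≤p r'≤r)
  where
  p+r<q+r' : p + r < q + r'
  p+r<q+r' = +-cancelˡ-< v _ _ (subst (v + (p + r) <_) (+-assoc v q r') (ℤₚ.drop‿+<+
    (subst₂ ℤ._<_ (sym (ℤₚ.pos-+ v (p + r))) (shifted-+ v q p r r') (ℤₚ.+-monoˡ-< (ℤ.+ (p + r)) v<shifted))))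

shifted->⇒< : ∀ v q p r r' → shifted v q p r r' ℤ.< ℤ.+ v → p ≤ q → r' < r
shifted->⇒< v q p r r' shifted<v p≤q = ≰⇒> λ r≤r' → <⇒≱ q+r'<p+r (+-mono-≤ p≤q r≤r')
  where
  q+r'<p+r : q + r' < p + r
  q+r'<p+r = +-cancelˡ-< v _ _ (subst (_< v + (p + r)) (+-assoc v q r') (ℤₚ.drop‿+<+
    (subst₂ ℤ._<_ (shifted-+ v q p r r') (sym (ℤₚ.pos-+ v (p + r))) (ℤₚ.+-monoˡ-< (ℤ.+ (p + r)) shifted<v))))

shiftedᵛ : ∀ {k} (v q p r r' : Vec ℕ k) → Vec ℤ k
shiftedᵛ v q p r r' =
  zipWith ℤ._-_ (zipWith ℤ._+_ (toℤ v) (zipWith ℤ._-_ (toℤ q) (toℤ p))) (zipWith ℤ._-_ (toℤ r) (toℤ r'))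

lookup-shiftedᵛ : ∀ {k} (v q p r r' : Vec ℕ k) c →
  lookup (shiftedᵛ v q p r r') c ≡ shifted (lookup v c) (lookup q c) (lookup p c) (lookup r c) (lookup r' c)
lookup-shiftedᵛ (_ ∷ _) (_ ∷ _) (_ ∷ _) (_ ∷ _) (_ ∷ _) fzero = refl
lookup-shiftedᵛ (_ ∷ v) (_ ∷ q) (_ ∷ p) (_ ∷ r) (_ ∷ r') (fsuc c) = lookup-shiftedᵛ v q p r r' c

sumℤ-shiftedᵛ : ∀ {k} (v q p r r' : Vec ℕ k) →
  sumℤ (shiftedᵛ v q p r r') ≡ shifted (sum v) (sum q) (sum p) (sum r) (sum r')
sumℤ-shiftedᵛ v q p r r' = begin
  sumℤ (shiftedᵛ v q p r r')
    ≡⟨ sumℤ-zipWith-- (zipWith ℤ._+_ (toℤ v) q-p) r-r' ⟩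
  sumℤ (zipWith ℤ._+_ (toℤ v) q-p) ℤ.- sumℤ r-r'
    ≡⟨ cong₂ ℤ._-_ (trans (sumℤ-zipWith-+ (toℤ v) q-p) (cong₂ ℤ._+_ (sumℤ-toℤ v) (difference q p))) (difference r r') ⟩
  shifted (sum v) (sum q) (sum p) (sum r) (sum r') ∎
  where
  open ≡-Reasoning
  q-p r-r' : Vec ℤ _
  q-p  = zipWith ℤ._-_ (toℤ q) (toℤ p)
  r-r' = zipWith ℤ._-_ (toℤ r) (toℤ r')
  difference : ∀ {k} (a b : Vec ℕ k) → sumℤ (zipWith ℤ._-_ (toℤ a) (toℤ b)) ≡ ℤ.+ sum a ℤ.- ℤ.+ sum b
  difference a b = trans (sumℤ-zipWith-- (toℤ a) (toℤ b)) (cong₂ ℤ._-_ (sumℤ-toℤ a) (sumℤ-toℤ b))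

module HerringboneHints {n k : ℕ} (S : Spine n k) (j : ℕ) (j≤L : j ≤ spineLen n k) where
  open SpineProperties S

  private
    L : ℕ
    L = spineLen n k
    s : ℕ → Vec ℕ k
    s = pt S
    top : Vec ℕ k
    top = replicate k (n ∸ 1)

  record Hint (v : Vec ℕ k) (a : Vec ℤ k) : Set where
    field
      level-up   : ℤ.+ sum v ℤ.< sumℤ a → sum v < j
      level-down : sumℤ a ℤ.< ℤ.+ sum v → j < sum v
      coord-up   : sumℤ a ≡ ℤ.+ sum v → ∀ c → ℤ.+ lookup v c ℤ.< lookup a c → lookup v c < lookup (s (sum v)) c
      coord-down : sumℤ a ≡ ℤ.+ sum v → ∀ c → lookup a c ℤ.< ℤ.+ lookup v c → lookup (s (sum v)) c < lookup v c

  rising-hint : ∀ {v a} → sumℤ a ≡ ℤ.+ suc (sum v) → sum v < j → Hint v a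
  rising-hint Σa≡1+Σv Σv<j = record
    { level-up   = λ _ → Σv<j
    ; level-down = λ Σa<Σv → ⊥-elim (ℤₚ.<-asym Σa<Σv (subst (ℤ.+ _ ℤ.<_) (sym Σa≡1+Σv) (ℤ.+<+ ≤-refl)))
    ; coord-up   = λ Σa≡Σv → contradiction (ℤₚ.+-injective (trans (sym Σa≡1+Σv) Σa≡Σv)) (1+n≢n)
    ; coord-down = λ Σa≡Σv → contradiction (ℤₚ.+-injective (trans (sym Σa≡1+Σv) Σa≡Σv)) (1+n≢n)
    }

  falling-hint : ∀ {v a l} → sumℤ a ≡ ℤ.+ l → l < sum v → j < sum v → Hint v a
  falling-hint {v} Σa≡l l<Σv j<Σv = record
    { level-up   = λ Σv<Σa → ⊥-elim (ℤₚ.<-asym Σv<Σa (subst (ℤ._< ℤ.+ sum v) (sym Σa≡l) (ℤ.+<+ l<Σv)))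
    ; level-down = λ _ → j<Σv
    ; coord-up   = λ Σa≡Σv → contradiction (ℤₚ.+-injective (trans (sym Σa≡l) Σa≡Σv)) (<⇒≢ l<Σv)
    ; coord-down = λ Σa≡Σv → contradiction (ℤₚ.+-injective (trans (sym Σa≡l) Σa≡Σv)) (<⇒≢ l<Σv)
    }

  fixed-hint : ∀ {v} → Hint v (toℤ v)
  fixed-hint {v} = record
    { level-up   = λ Σv<Σv → contradiction (sym (sumℤ-toℤ v)) (ℤₚ.<⇒≢ Σv<Σv)
    ; level-down = λ Σv<Σv → contradiction (sumℤ-toℤ v) (ℤₚ.<⇒≢ Σv<Σv)
    ; coord-up   = λ _ c vc<vc → contradiction (sym (Vecₚ.lookup-map c (λ x → ℤ.+ x) v)) (ℤₚ.<⇒≢ vc<vc)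
    ; coord-down = λ _ c vc<vc → contradiction (Vecₚ.lookup-map c (λ x → ℤ.+ x) v) (ℤₚ.<⇒≢ vc<vc)
    }

  module OffSpine {v} (v≤top : v ≤ᵛ top) (off : ∀ {i} → i ≤ L → s i ≢ v) where

    private
      lower upper : ℕ
      lower = μ S v
      upper = M S v

    lower-spec : IsGreatest≤ (λ i → Pointwise.decidable _≤?_ (s i) v) L lower
    lower-spec = greatest≤-spec _ (subst (_≤ᵛ v) (sym (start S)) (replicate-0-≤ᵛ v))

    upper-spec : IsLeast≤ (λ i → Pointwise.decidable _≤?_ v (s i)) L upper
    upper-spec = least≤-spec _ (subst (v ≤ᵛ_) (sym (end S)) v≤top)

    open IsGreatest≤ lower-spec renaming (bound to lower≤L; holds to lower≤v; greatest to lower-greatest)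
    open IsLeast≤ upper-spec renaming (bound to upper≤L; holds to v≤upper; least to upper-least)

    lower<Σv : lower < sum v
    lower<Σv = subst (_< sum v) (sum-pt lower≤L) (<ᵛ⇒sum< (lower≤v , off lower≤L))

    Σv<upper : sum v < upper
    Σv<upper = subst (sum v <_) (sum-pt upper≤L) (<ᵛ⇒sum< (v≤upper , off upper≤L ∘ sym))

    Σv≤L : sum v ≤ L
    Σv≤L = sum-≤-top v≤top

    lower<L : lower < L
    lower<L = <-≤-trans lower<Σv Σv≤L

    upper≡1+ : suc (upper ∸ 1) ≡ upper
    upper≡1+ = suc-pred upper {{>-nonZero (m<n⇒0<n Σv<upper)}}

    upper∸1<L : upper ∸ 1 < L
    upper∸1<L = subst (_≤ L) (sym upper≡1+) upper≤L

    Σv≤upper∸1 : sum v ≤ upper ∸ 1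
    Σv≤upper∸1 = ≤-pred (subst (sum v <_) (sym upper≡1+) Σv<upper)

    last-step-unit : ∀ {c} → lookup (s (upper ∸ 1)) c < lookup (s upper) c →
                     ∀ {c'} → c' ≢ c → lookup (s (upper ∸ 1)) c' ≡ lookup (s upper) c'
    last-step-unit = subst (λ u → ∀ {c} → lookup (s (upper ∸ 1)) c < lookup (s u) c → ∀ {c'} → c' ≢ c →
                                  lookup (s (upper ∸ 1)) c' ≡ lookup (s u) c')
                           upper≡1+ (pt-unit-step upper∸1<L)

    answer : Vec ℤ k
    answer = shiftedᵛ v (s (suc lower)) (s lower) (s upper) (s (upper ∸ 1))

    sumℤ-answer : sumℤ answer ≡ ℤ.+ sum v
    sumℤ-answer = begin
      sumℤ answer
        ≡⟨ sumℤ-shiftedᵛ v (s (suc lower)) (s lower) (s upper) (s (upper ∸ 1)) ⟩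
      shifted (sum v) (sum (s (suc lower))) (sum (s lower)) (sum (s upper)) (sum (s (upper ∸ 1)))
        ≡⟨ cong₂ (λ q p → shifted (sum v) q p (sum (s upper)) (sum (s (upper ∸ 1))))
                 (sum-pt lower<L) (sum-pt lower≤L) ⟩
      shifted (sum v) (suc lower) lower (sum (s upper)) (sum (s (upper ∸ 1)))
        ≡⟨ cong₂ (shifted (sum v) (suc lower) lower)
                 (trans (sum-pt upper≤L) (sym upper≡1+)) (sum-pt (<⇒≤ upper∸1<L)) ⟩
      shifted (sum v) (suc lower) lower (suc (upper ∸ 1)) (upper ∸ 1)
        ≡⟨ shifted-unit (sum v) lower (upper ∸ 1) ⟩
      ℤ.+ sum v ∎
      where open ≡-Reasoning

    -- A coordinate rises only where the step from s lower to s (suc lower) rises, and there this step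
    -- passes v, since s (suc lower) ≰ v while the other coordinates of the step stay below v.
    -- Falls are symmetric, with the step into s upper.
    answer-up : ∀ c → ℤ.+ lookup v c ℤ.< lookup answer c → lookup v c < lookup (s (sum v)) c
    answer-up c vc<ac = <-≤-trans v<next (≤ᵛ-lookup (pt-mono lower<Σv Σv≤L) c)
      where
      step-rises : lookup (s lower) c < lookup (s (suc lower)) c
      step-rises = shifted-<⇒< (lookup v c) _ _ _ _
                     (subst (ℤ.+ lookup v c ℤ.<_) (lookup-shiftedᵛ v _ _ _ _ c) vc<ac)
                     (≤ᵛ-lookup (pt-mono (m∸n≤m upper 1) upper≤L) c)
      v<next : lookup v c < lookup (s (suc lower)) c
      v<next = ≰⇒> λ next≤v → lower-greatest ≤-refl lower<L (≤ᵛ-except c next≤v λ c'≢c →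
                 subst (_≤ lookup v _) (pt-unit-step lower<L step-rises c'≢c) (≤ᵛ-lookup lower≤v _))

    answer-down : ∀ c → lookup answer c ℤ.< ℤ.+ lookup v c → lookup (s (sum v)) c < lookup v c
    answer-down c ac<vc = ≤-<-trans (≤ᵛ-lookup (pt-mono Σv≤upper∸1 (<⇒≤ upper∸1<L)) c) previous<v
      where
      step-rises : lookup (s (upper ∸ 1)) c < lookup (s upper) c
      step-rises = shifted->⇒< (lookup v c) _ _ _ _
                     (subst (ℤ._< ℤ.+ lookup v c) (lookup-shiftedᵛ v _ _ _ _ c) ac<vc)
                     (≤ᵛ-lookup (pt-mono (n≤1+n lower) lower<L) c)
      previous<v : lookup (s (upper ∸ 1)) c < lookup v c
      previous<v = ≰⇒> λ v≤previous → upper-least (subst (upper ∸ 1 <_) upper≡1+ ≤-refl)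
                     (≤ᵛ-except c v≤previous λ c'≢c →
                       subst (lookup v _ ≤_) (sym (last-step-unit step-rises c'≢c)) (≤ᵛ-lookup v≤upper _))

    hint : Hint v answer
    hint = record
      { level-up   = λ Σv<Σa → contradiction (sym sumℤ-answer) (ℤₚ.<⇒≢ Σv<Σa)
      ; level-down = λ Σa<Σv → contradiction sumℤ-answer (ℤₚ.<⇒≢ Σa<Σv)
      ; coord-up   = λ _ → answer-up
      ; coord-down = λ _ → answer-down
      }

  spineIndex-just : ∀ {v i} → spineIndex S v ≡ just i → i ≤ L × s i ≡ v
  spineIndex-just {v} e with i<1+L , si≡v , _ ← firstBelow-just (λ i → Vecₚ.≡-dec _≟_ (s i) v) (suc L) e =
    ≤-pred i<1+L , si≡v

  spineIndex-nothing : ∀ {v} → spineIndex S v ≡ nothing → ∀ {i} → i ≤ L → s i ≢ v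
  spineIndex-nothing {v} e i≤L = firstBelow-nothing (λ i → Vecₚ.≡-dec _≟_ (s i) v) (suc L) e (s≤s i≤L)

  herringbone-at-j : herringbone S j (s j) ≡ toℤ (s j)
  herringbone-at-j with spineIndex S (s j) in e
  ... | nothing = contradiction refl (spineIndex-nothing e j≤L)
  ... | just i with i≤L , si≡sj ← spineIndex-just e with i <? j | j <? i
  ...   | yes i<j | _       = contradiction (pt-injective i≤L j≤L si≡sj) (<⇒≢ i<j)
  ...   | no _    | yes j<i = contradiction (pt-injective i≤L j≤L si≡sj) (>⇒≢ j<i)
  ...   | no _    | no _    = refl

  spine-below-hint : ∀ {i} → i < j → Hint (s i) (toℤ (s (suc i)))
  spine-below-hint {i} i<j = rising-hint
    (trans (sumℤ-toℤ (s (suc i))) (cong ℤ.+_ (trans (sum-pt i<L) (cong suc (sym (sum-pt (<⇒≤ i<L)))))))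
    (subst (_< j) (sym (sum-pt (<⇒≤ i<L))) i<j)
    where
    i<L : i < L
    i<L = <-≤-trans i<j j≤L

  spine-above-hint : ∀ {i} → j < i → i ≤ L → Hint (s i) (toℤ (s (i ∸ 1)))
  spine-above-hint {i} j<i i≤L = falling-hint
    (trans (sumℤ-toℤ (s (i ∸ 1))) (cong ℤ.+_ (sum-pt (≤-trans (m∸n≤m i 1) i≤L))))
    (subst (i ∸ 1 <_) (sym (sum-pt i≤L)) (∸-monoʳ-< {o = 0} z<s (m<n⇒0<n j<i)))
    (subst (j <_) (sym (sum-pt i≤L)) j<i)

  herringbone-hint : ∀ {v} → v ≤ᵛ top → Hint v (herringbone S j v)
  herringbone-hint {v} v≤top with spineIndex S v in e
  ... | nothing = OffSpine.hint v≤top (spineIndex-nothing e)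
  ... | just i with i≤L , refl ← spineIndex-just e with i <? j | j <? i
  ...   | yes i<j | _       = spine-below-hint i<j
  ...   | no _    | yes j<i = spine-above-hint j<i i≤L
  ...   | no _    | no _    = fixed-hint

data Search (n k : ℕ) (A : Set) : Set where
  done : A → Search n k A
  ask  : Point n k → (Vec ℤ k → Search n k A) → Search n k A

module _ {n k : ℕ} where

  runSearch : ∀ {A} → Search n k A → (Vec ℕ k → Vec ℤ k) → A × ℕ
  runSearch (done x)  f = x , 0
  runSearch (ask p c) f = Prod.map₂ suc (runSearch (c (f (coords p))) f)

  _>>=_ : ∀ {A B} → Search n k A → (A → Search n k B) → Search n k B
  done x  >>= g = g x
  ask p c >>= g = ask p (λ a → c a >>= g)

  toQueryAlg : Search n k (Point n k) → QueryAlg n k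
  toQueryAlg (done p)  = output p
  toQueryAlg (ask p c) = query p (toQueryAlg ∘ c)

  run-toQueryAlg : ∀ t f → run (toQueryAlg t) f ≡ runSearch t f
  run-toQueryAlg (done p)  f = refl
  run-toQueryAlg (ask p c) f rewrite run-toQueryAlg (c (f (coords p))) f = refl

  record Yields {A} (f : Vec ℕ k → Vec ℤ k) (t : Search n k A) (P : A → Set) (B : ℕ) : Set where
    field
      result-ok : P (proj₁ (runSearch t f))
      cost≤     : proj₂ (runSearch t f) ≤ B

  yields-weaken : ∀ {f A} {P : A → Set} {t B B'} → B ≤ B' → Yields f t P B → Yields f t P B'
  yields-weaken B≤B' y = record { result-ok = Yields.result-ok y ; cost≤ = ≤-trans (Yields.cost≤ y) B≤B' }

  module _ {f : Vec ℕ k → Vec ℤ k} where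

    yields-done : ∀ {A} {P : A → Set} {x B} → P x → Yields f (done x) P B
    yields-done Px = record { result-ok = Px ; cost≤ = z≤n }

    yields-ask : ∀ {A} {P : A → Set} {p c B} → Yields f (c (f (coords p))) P B → Yields f (ask p c) P (suc B)
    yields-ask y = record { result-ok = Yields.result-ok y ; cost≤ = s≤s (Yields.cost≤ y) }

    yields->>= : ∀ {A C} {P : A → Set} {Q : C → Set} {t g B B'} →
                 Yields f t P B → (∀ {x} → P x → Yields f (g x) Q B') → Yields f (t >>= g) Q (B + B')
    yields->>= {t = done x}  y next = yields-weaken (m≤n+m _ _) (next (Yields.result-ok y))
    yields->>= {t = ask p c} {B = zero}  y next with () ← Yields.cost≤ y
    yields->>= {t = ask p c} {B = suc B} y next = yields-ask (yields->>= {t = c (f (coords p))}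
      (record { result-ok = Yields.result-ok y ; cost≤ = ≤-pred (Yields.cost≤ y) }) next)

-- Halving

⌈/2⌉+⌈/2⌉≤1+n : ∀ n → ⌈ n /2⌉ + ⌈ n /2⌉ ≤ suc n
⌈/2⌉+⌈/2⌉≤1+n n =
  subst (⌈ n /2⌉ + ⌈ n /2⌉ ≤_) (⌊n/2⌋+⌈n/2⌉≡n (suc n)) (+-monoʳ-≤ ⌈ n /2⌉ (⌈n/2⌉-mono (n≤1+n n)))

n≤⌈/2⌉+⌈/2⌉ : ∀ n → n ≤ ⌈ n /2⌉ + ⌈ n /2⌉
n≤⌈/2⌉+⌈/2⌉ n =
  subst (_≤ ⌈ n /2⌉ + ⌈ n /2⌉) (⌊n/2⌋+⌈n/2⌉≡n n) (+-monoˡ-≤ ⌈ n /2⌉ (⌊n/2⌋≤⌈n/2⌉ n))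

sum≤sum⌈/2⌉+sum⌈/2⌉ : ∀ {k} (w : Vec ℕ k) → sum w ≤ sum (map ⌈_/2⌉ w) + sum (map ⌈_/2⌉ w)
sum≤sum⌈/2⌉+sum⌈/2⌉ []      = z≤n
sum≤sum⌈/2⌉+sum⌈/2⌉ (x ∷ w) = subst (x + sum w ≤_) (+-interchange ⌈ x /2⌉ ⌈ x /2⌉ _ _)
  (+-mono-≤ (n≤⌈/2⌉+⌈/2⌉ x) (sum≤sum⌈/2⌉+sum⌈/2⌉ w))

suc-∸ : ∀ {m n} → n ≤ m → suc (m ∸ n) ≡ suc m ∸ n
suc-∸ n≤m = sym (+-∸-assoc 1 n≤m)

⌈log₂⌉-halving : ∀ {a b} → 1 ≤ a → a + a ≤ b → ⌈log₂ a ⌉ < ⌈log₂ b ⌉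
⌈log₂⌉-halving {suc a} {b} _ a+a≤b = subst (_≤ ⌈log₂ b ⌉) (⌈log₂2*n⌉≡1+⌈log₂n⌉ (suc a))
  (⌈log₂⌉-mono-≤ (subst (λ z → suc a + z ≤ b) (sym (+-identityʳ (suc a))) a+a≤b))

fill : ∀ {k} → Vec ℕ k → ℕ → Vec ℕ k
fill []       r = []
fill (u ∷ us) r = (u ⊓ r) ∷ fill us (r ∸ u)

fill-≤ᵛ : ∀ {k} (u : Vec ℕ k) r → fill u r ≤ᵛ u
fill-≤ᵛ []       r = Pointwise.[]
fill-≤ᵛ (u ∷ us) r = m⊓n≤m u r Pointwise.∷ fill-≤ᵛ us (r ∸ u)

sum-fill : ∀ {k} (u : Vec ℕ k) {r} → r ≤ sum u → sum (fill u r) ≡ r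
sum-fill []       z≤n = refl
sum-fill (u ∷ us) {r} r≤Σ with r ≤? u
... | yes r≤u = trans (cong₂ _+_ (m≥n⇒m⊓n≡n r≤u) (trans (cong (sum ∘ fill us) (m≤n⇒m∸n≡0 r≤u)) (sum-fill us z≤n)))
                    (+-identityʳ r)
... | no r≰u  = trans (cong₂ _+_ (m≤n⇒m⊓n≡m u≤r) (sum-fill us (m≤n+o⇒m∸n≤o r u r≤Σ))) (m+[n∸m]≡n u≤r)
  where
  u≤r : u ≤ r
  u≤r = <⇒≤ (≰⇒> r≰u)

record BalancedSplit {k} (w : Vec ℕ k) (r : ℕ) (x : Vec ℕ k) : Set where
  field
    x≤w      : x ≤ᵛ w
    sum≡     : sum x ≡ r
    balanced : (∀ c → lookup x c + lookup x c ≤ suc (lookup w c))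
             ⊎ (∀ c → (lookup w c ∸ lookup x c) + (lookup w c ∸ lookup x c) ≤ suc (lookup w c))

-- Either the r units fit into the lower halves of the coordinates, or the remaining sum w ∸ r units
-- fit into the upper halves.
balancedSplit : ∀ {k} → Vec ℕ k → ℕ → Vec ℕ k
balancedSplit w r with r ≤? sum (map ⌈_/2⌉ w)
... | yes _ = fill (map ⌈_/2⌉ w) r
... | no _  = zipWith _∸_ w (fill (map ⌈_/2⌉ w) (sum w ∸ r))

module _ {k} (w : Vec ℕ k) where

  private
    halves : Vec ℕ k
    halves = map ⌈_/2⌉ w

  fill-halves-≤ᵛ : ∀ r → fill halves r ≤ᵛ w
  fill-halves-≤ᵛ r = ≤ᵛ-trans (fill-≤ᵛ halves r)
    (lookup⇒≤ᵛ λ c → subst (_≤ lookup w c) (sym (Vecₚ.lookup-map c ⌈_/2⌉ w)) (⌈n/2⌉≤n (lookup w c)))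

  fill-halves-balanced : ∀ r c → lookup (fill halves r) c + lookup (fill halves r) c ≤ suc (lookup w c)
  fill-halves-balanced r c = ≤-trans (+-mono-≤ yc≤half yc≤half) (⌈/2⌉+⌈/2⌉≤1+n (lookup w c))
    where
    yc≤half : lookup (fill halves r) c ≤ ⌈ lookup w c /2⌉
    yc≤half = subst (lookup (fill halves r) c ≤_) (Vecₚ.lookup-map c ⌈_/2⌉ w) (≤ᵛ-lookup (fill-≤ᵛ halves r) c)

  balancedSplit-spec : ∀ {r} → r ≤ sum w → BalancedSplit w r (balancedSplit w r)
  balancedSplit-spec {r} r≤Σw with r ≤? sum halves
  ... | yes r≤Σh = record
    { x≤w      = fill-halves-≤ᵛ r
    ; sum≡     = sum-fill halves r≤Σh
    ; balanced = inj₁ (fill-halves-balanced r)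
    }
  ... | no r≰Σh = record
    { x≤w      = lookup⇒≤ᵛ λ c →
                   subst (_≤ lookup w c) (sym (Vecₚ.lookup-zipWith _∸_ c w y)) (m∸n≤m (lookup w c) (lookup y c))
    ; sum≡     = +-cancelʳ-≡ (sum y) _ _ (trans (sum-∸ᵛ y≤w) (sym (trans (cong (r +_) Σy≡) (m+[n∸m]≡n r≤Σw))))
    ; balanced = inj₂ λ c →
                   subst (λ z → z + z ≤ suc (lookup w c)) (sym (upper-part c)) (fill-halves-balanced (sum w ∸ r) c)
    }
    where
    y : Vec ℕ k
    y = fill halves (sum w ∸ r)
    y≤w : y ≤ᵛ w
    y≤w = fill-halves-≤ᵛ (sum w ∸ r)
    Σy≡ : sum y ≡ sum w ∸ r
    Σy≡ = sum-fill halves (m≤n+o⇒m∸n≤o (sum w) r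
            (≤-trans (sum≤sum⌈/2⌉+sum⌈/2⌉ w) (+-monoˡ-≤ (sum halves) (<⇒≤ (≰⇒> r≰Σh)))))
    upper-part : ∀ c → lookup w c ∸ lookup (zipWith _∸_ w y) c ≡ lookup y c
    upper-part c = trans (cong (lookup w c ∸_) (Vecₚ.lookup-zipWith _∸_ c w y)) (m∸[m∸n]≡n (≤ᵛ-lookup y≤w c))

raise : ℕ → ℤ → ℕ → ℕ
raise v a l with ℤ.+ v ℤₚ.<? a
... | yes _ = suc v
... | no _  = l

cut : ℕ → ℤ → ℕ → ℕ
cut v a h with a ℤₚ.<? ℤ.+ v
... | yes _ = v ∸ 1
... | no _  = h

module _ {v : ℕ} {a : ℤ} where

  raise-up : ∀ {l} → ℤ.+ v ℤ.< a → raise v a l ≡ suc v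
  raise-up {l} v<a with ℤ.+ v ℤₚ.<? a
  ... | yes _   = refl
  ... | no v≮a = contradiction v<a v≮a

  raise-stay : ∀ {l} → ¬ (ℤ.+ v ℤ.< a) → raise v a l ≡ l
  raise-stay {l} v≮a with ℤ.+ v ℤₚ.<? a
  ... | yes v<a = contradiction v<a v≮a
  ... | no _    = refl

  cut-down : ∀ {h} → a ℤ.< ℤ.+ v → cut v a h ≡ v ∸ 1
  cut-down {h} a<v with a ℤₚ.<? ℤ.+ v
  ... | yes _   = refl
  ... | no a≮v = contradiction a<v a≮v

  cut-stay : ∀ {h} → ¬ (a ℤ.< ℤ.+ v) → cut v a h ≡ h
  cut-stay {h} a≮v with a ℤₚ.<? ℤ.+ v
  ... | yes a<v = contradiction a<v a≮v
  ... | no _    = refl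

  ≤-raise : ∀ {l} → l ≤ v → l ≤ raise v a l
  ≤-raise {l} l≤v with ℤ.+ v ℤₚ.<? a
  ... | yes _ = m≤n⇒m≤1+n l≤v
  ... | no _  = ≤-refl

  raise-≤ : ∀ {l t} → l ≤ t → (ℤ.+ v ℤ.< a → v < t) → raise v a l ≤ t
  raise-≤ {l} l≤t up with ℤ.+ v ℤₚ.<? a
  ... | yes v<a = up v<a
  ... | no _    = l≤t

  cut-≤ : ∀ {h} → v ≤ h → cut v a h ≤ h
  cut-≤ {h} v≤h with a ℤₚ.<? ℤ.+ v
  ... | yes _ = ≤-trans (m∸n≤m v 1) v≤h
  ... | no _  = ≤-refl

  ≤-cut : ∀ {h t} → t ≤ h → (a ℤ.< ℤ.+ v → t < v) → t ≤ cut v a h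
  ≤-cut {h} t≤h down with a ℤₚ.<? ℤ.+ v
  ... | yes a<v = <⇒≤pred (down a<v)
  ... | no _    = t≤h

midpoint : ℕ → ℕ → ℕ
midpoint α β = α + ⌊ (β ∸ α) /2⌋

midpoint-≤ : ∀ {α β} → α ≤ β → midpoint α β ≤ β
midpoint-≤ {α} {β} α≤β = subst (midpoint α β ≤_) (m+[n∸m]≡n α≤β) (+-monoʳ-≤ α (⌊n/2⌋≤n (β ∸ α)))

upper-half-smaller : ∀ {α β} → midpoint α β < β →
                     ⌈log₂ suc (β ∸ suc (midpoint α β)) ⌉ < ⌈log₂ suc (β ∸ α) ⌉
upper-half-smaller {α} {β} mid<β = ⌈log₂⌉-halving (s≤s z≤n)
  (subst (λ z → z + z ≤ suc (β ∸ α)) (sym size≡) (⌈/2⌉+⌈/2⌉≤1+n (β ∸ α)))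
  where
  d : ℕ
  d = β ∸ α
  size≡ : suc (β ∸ suc (midpoint α β)) ≡ ⌈ d /2⌉
  size≡ = begin
    suc (β ∸ suc (midpoint α β)) ≡⟨ suc-∸ mid<β ⟩
    β ∸ (α + ⌊ d /2⌋)            ≡⟨ ∸-+-assoc β α ⌊ d /2⌋ ⟨
    d ∸ ⌊ d /2⌋                  ≡⟨ cong (_∸ ⌊ d /2⌋) (⌊n/2⌋+⌈n/2⌉≡n d) ⟨
    ⌊ d /2⌋ + ⌈ d /2⌉ ∸ ⌊ d /2⌋  ≡⟨ m+n∸m≡n ⌊ d /2⌋ ⌈ d /2⌉ ⟩
    ⌈ d /2⌉                      ∎
    where open ≡-Reasoning

lower-half-smaller : ∀ {α β} → α < midpoint α β →
                     ⌈log₂ suc (midpoint α β ∸ 1 ∸ α) ⌉ < ⌈log₂ suc (β ∸ α) ⌉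
lower-half-smaller {α} {β} α<mid = ⌈log₂⌉-halving (s≤s z≤n)
  (subst (λ z → z + z ≤ suc d) (sym size≡)
    (m≤n⇒m≤1+n (subst (⌊ d /2⌋ + ⌊ d /2⌋ ≤_) (⌊n/2⌋+⌈n/2⌉≡n d) (+-monoʳ-≤ ⌊ d /2⌋ (⌊n/2⌋≤⌈n/2⌉ d)))))
  where
  d : ℕ
  d = β ∸ α
  size≡ : suc (midpoint α β ∸ 1 ∸ α) ≡ ⌊ d /2⌋
  size≡ = trans (suc-∸ (<⇒≤pred α<mid)) (trans (cong (_∸ α) (suc-pred (midpoint α β) {{>-nonZero (m<n⇒0<n α<mid)}}))
                                                  (m+n∸m≡n α ⌊ d /2⌋))

coords-map-mod : ∀ {m k} {v : Vec ℕ k} → v ≤ᵛ replicate k m → coords (map (_mod suc m) v) ≡ v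
coords-map-mod Pointwise.[] = refl
coords-map-mod {m} {v = x ∷ v} (x≤m Pointwise.∷ v≤m) =
  cong₂ _∷_ (trans (Finₚ.toℕ-fromℕ< _) (m<n⇒m%n≡m (s≤s x≤m))) (coords-map-mod v≤m)

data Verdict (n k : ℕ) : Set where
  found                 : Point n k → Verdict n k
  raiseLevel lowerLevel : Verdict n k
  gaveUp                : Verdict n k

module Algorithm (m k : ℕ) where

  toPoint : Vec ℕ k → Point (suc m) k
  toPoint = map (_mod suc m)

  probe : ℕ → Vec ℕ k → Vec ℕ k → Vec ℕ k
  probe ℓ lo hi = zipWith _+_ lo (balancedSplit (zipWith _∸_ hi lo) (ℓ ∸ sum lo))

  raiseᵛ cutᵛ : Vec ℕ k → Vec ℤ k → Vec ℕ k → Vec ℕ k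
  raiseᵛ v a lo = tabulate λ c → raise (lookup v c) (lookup a c) (lookup lo c)
  cutᵛ   v a hi = tabulate λ c → cut (lookup v c) (lookup a c) (lookup hi c)

  levelSearch : ℕ → ℕ → Vec ℕ k → Vec ℕ k → Search (suc m) k (Verdict (suc m) k)
  interpret   : ℕ → ℕ → Vec ℕ k → Vec ℕ k → Vec ℕ k → Vec ℤ k → Search (suc m) k (Verdict (suc m) k)

  levelSearch zero    ℓ lo hi = done gaveUp
  levelSearch (suc f) ℓ lo hi = ask (toPoint (probe ℓ lo hi)) (interpret f ℓ lo hi (probe ℓ lo hi))

  interpret f ℓ lo hi v a with Vecₚ.≡-dec ℤₚ._≟_ a (toℤ v)
  ... | yes _ = done (found (toPoint v))
  ... | no _ with ℤₚ.<-cmp (ℤ.+ ℓ) (sumℤ a)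
  ...   | tri< _ _ _ = done raiseLevel
  ...   | tri> _ _ _ = done lowerLevel
  ...   | tri≈ _ _ _ = levelSearch f ℓ (raiseᵛ v a lo) (cutᵛ v a hi)

  bottom top : Vec ℕ k
  bottom = replicate k 0
  top    = replicate k m

  queriesPerLevel : ℕ
  queriesPerLevel = suc (k * ⌈log₂ suc m ⌉)

  binarySearch : ℕ → ℕ → ℕ → Search (suc m) k (Point (suc m) k)
  continue     : ℕ → ℕ → ℕ → Verdict (suc m) k → Search (suc m) k (Point (suc m) k)

  binarySearch zero    α β = done (toPoint bottom)
  binarySearch (suc f) α β = levelSearch queriesPerLevel (midpoint α β) bottom top >>= continue f α β

  continue f α β (found p)  = done p
  continue f α β raiseLevel = binarySearch f (suc (midpoint α β)) β
  continue f α β lowerLevel = binarySearch f α (midpoint α β ∸ 1)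
  continue f α β gaveUp     = done (toPoint bottom)

  algorithm : QueryAlg (suc m) k
  algorithm = toQueryAlg (binarySearch (suc ⌈log₂ suc (m * k) ⌉) 0 (m * k))

module Correctness {m k : ℕ} (S : Spine (suc m) k) (j : ℕ) (j≤L : j ≤ m * k) where
  open Algorithm m k
  open SpineProperties S
  open HerringboneHints S j j≤L

  private
    L : ℕ
    L = m * k
    s : ℕ → Vec ℕ k
    s = pt S
    h : Vec ℕ k → Vec ℤ k
    h = herringbone S j

  Fixed : Point (suc m) k → Set
  Fixed p = h (coords p) ≡ toℤ (coords p)

  Sound : ℕ → Verdict (suc m) k → Set
  Sound ℓ (found p)  = Fixed p
  Sound ℓ raiseLevel = ℓ < j
  Sound ℓ lowerLevel = j < ℓ
  Sound ℓ gaveUp     = ⊥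

  record Box (ℓ : ℕ) (lo hi : Vec ℕ k) : Set where
    field
      ℓ≤L      : ℓ ≤ L
      lo≤spine : lo ≤ᵛ s ℓ
      spine≤hi : s ℓ ≤ᵛ hi
      hi≤top   : hi ≤ᵛ top

  size : ℕ → ℕ → ℕ
  size l u = ⌈log₂ suc (u ∸ l) ⌉

  potential : Vec ℕ k → Vec ℕ k → ℕ
  potential lo hi = sum (zipWith size lo hi)

  module Probe {ℓ lo hi} (box : Box ℓ lo hi) where
    open Box box

    width : Vec ℕ k
    width = zipWith _∸_ hi lo

    x v : Vec ℕ k
    x = balancedSplit width (ℓ ∸ sum lo)
    v = probe ℓ lo hi

    lo≤hi : lo ≤ᵛ hi
    lo≤hi = ≤ᵛ-trans lo≤spine spine≤hi

    Σlo≤ℓ : sum lo ≤ ℓ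
    Σlo≤ℓ = subst (sum lo ≤_) (sum-pt ℓ≤L) (sum-mono-≤ᵛ lo≤spine)

    budget≤Σwidth : ℓ ∸ sum lo ≤ sum width
    budget≤Σwidth = m≤n+o⇒m∸n≤o ℓ (sum lo)
      (subst (ℓ ≤_) (trans (sym (sum-∸ᵛ lo≤hi)) (+-comm (sum width) (sum lo)))
             (subst (_≤ sum hi) (sum-pt ℓ≤L) (sum-mono-≤ᵛ spine≤hi)))

    split : BalancedSplit width (ℓ ∸ sum lo) x
    split = balancedSplit-spec width budget≤Σwidth

    open BalancedSplit split public

    lookup-v : ∀ c → lookup v c ≡ lookup lo c + lookup x c
    lookup-v c = Vecₚ.lookup-zipWith _+_ c lo x

    lookup-width : ∀ c → lookup width c ≡ lookup hi c ∸ lookup lo c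
    lookup-width c = Vecₚ.lookup-zipWith _∸_ c hi lo

    lo≤v : lo ≤ᵛ v
    lo≤v = lookup⇒≤ᵛ λ c → subst (lookup lo c ≤_) (sym (lookup-v c)) (m≤m+n _ _)

    v≤hi : v ≤ᵛ hi
    v≤hi = lookup⇒≤ᵛ λ c → subst₂ _≤_ (sym (lookup-v c)) (m+[n∸m]≡n (≤ᵛ-lookup lo≤hi c))
      (+-monoʳ-≤ (lookup lo c) (subst (lookup x c ≤_) (lookup-width c) (≤ᵛ-lookup x≤w c)))

    v≤top : v ≤ᵛ top
    v≤top = ≤ᵛ-trans v≤hi hi≤top

    sum-v : sum v ≡ ℓ
    sum-v = trans (sum-zipWith-+ lo x) (trans (cong (sum lo +_) sum≡) (m+[n∸m]≡n Σlo≤ℓ))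

    coords-v : coords (toPoint v) ≡ v
    coords-v = coords-map-mod v≤top

    level-below : ℤ.+ ℓ ℤ.< sumℤ (h v) → ℓ < j
    level-below ℓ<Σa = subst (_< j) sum-v
      (Hint.level-up (herringbone-hint v≤top) (subst (λ i → ℤ.+ i ℤ.< sumℤ (h v)) (sym sum-v) ℓ<Σa))

    level-above : sumℤ (h v) ℤ.< ℤ.+ ℓ → j < ℓ
    level-above Σa<ℓ = subst (j <_) sum-v
      (Hint.level-down (herringbone-hint v≤top) (subst (λ i → sumℤ (h v) ℤ.< ℤ.+ i) (sym sum-v) Σa<ℓ))

  module Shrink {ℓ lo hi} (box : Box ℓ lo hi) (a≢v : h (probe ℓ lo hi) ≢ toℤ (probe ℓ lo hi))
                (ℓ≡Σa : ℤ.+ ℓ ≡ sumℤ (h (probe ℓ lo hi))) where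
    open Box box
    open Probe box

    a : Vec ℤ k
    a = h v

    lo' hi' : Vec ℕ k
    lo' = raiseᵛ v a lo
    hi' = cutᵛ v a hi

    private
      hint : Hint v a
      hint = herringbone-hint v≤top

      Σa≡Σv : sumℤ a ≡ ℤ.+ sum v
      Σa≡Σv = trans (sym ℓ≡Σa) (cong ℤ.+_ (sym sum-v))

      Σv≡Σa : sumℤ (toℤ v) ≡ sumℤ a
      Σv≡Σa = trans (sumℤ-toℤ v) (sym Σa≡Σv)

      lookup-toℤ : ∀ c → lookup (toℤ v) c ≡ ℤ.+ lookup v c
      lookup-toℤ c = Vecₚ.lookup-map c (λ y → ℤ.+ y) v

    up : ∀ c → ℤ.+ lookup v c ℤ.< lookup a c → lookup v c < lookup (s ℓ) c
    up c = subst (λ i → ℤ.+ lookup v c ℤ.< lookup a c → lookup v c < lookup (s i) c) sum-v (Hint.coord-up hint Σa≡Σv c)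

    down : ∀ c → lookup a c ℤ.< ℤ.+ lookup v c → lookup (s ℓ) c < lookup v c
    down c = subst (λ i → lookup a c ℤ.< ℤ.+ lookup v c → lookup (s i) c < lookup v c) sum-v
                   (Hint.coord-down hint Σa≡Σv c)

    lookup-lo' : ∀ c → lookup lo' c ≡ raise (lookup v c) (lookup a c) (lookup lo c)
    lookup-lo' c = Vecₚ.lookup∘tabulate _ c

    lookup-hi' : ∀ c → lookup hi' c ≡ cut (lookup v c) (lookup a c) (lookup hi c)
    lookup-hi' c = Vecₚ.lookup∘tabulate _ c

    box' : Box ℓ lo' hi'
    box' = record
      { ℓ≤L      = ℓ≤L
      ; lo≤spine = lookup⇒≤ᵛ λ c →
                     subst (_≤ lookup (s ℓ) c) (sym (lookup-lo' c)) (raise-≤ (≤ᵛ-lookup lo≤spine c) (up c))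
      ; spine≤hi = lookup⇒≤ᵛ λ c →
                     subst (lookup (s ℓ) c ≤_) (sym (lookup-hi' c)) (≤-cut (≤ᵛ-lookup spine≤hi c) (down c))
      ; hi≤top   = ≤ᵛ-trans (lookup⇒≤ᵛ λ c →
                     subst (_≤ lookup hi c) (sym (lookup-hi' c)) (cut-≤ {a = lookup a c} (≤ᵛ-lookup v≤hi c))) hi≤top
      }

    size-mono : ∀ c → size (lookup lo' c) (lookup hi' c) ≤ size (lookup lo c) (lookup hi c)
    size-mono c = ⌈log₂⌉-mono-≤ (s≤s (∸-mono
      (subst (_≤ lookup hi c) (sym (lookup-hi' c)) (cut-≤ {a = lookup a c} (≤ᵛ-lookup v≤hi c)))
      (subst (lookup lo c ≤_) (sym (lookup-lo' c)) (≤-raise {a = lookup a c} (≤ᵛ-lookup lo≤v c)))))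

    side-after-fall : ∀ c → lookup a c ℤ.< ℤ.+ lookup v c → suc (lookup hi' c ∸ lookup lo' c) ≡ lookup x c
    side-after-fall c a<v = begin
      suc (lookup hi' c ∸ lookup lo' c)       ≡⟨ cong₂ (λ u l → suc (u ∸ l)) (trans (lookup-hi' c) (cut-down a<v))
                                                                      (trans (lookup-lo' c) (raise-stay (ℤₚ.<-asym a<v))) ⟩
      suc (lookup v c ∸ 1 ∸ lookup lo c)      ≡⟨ suc-∸ (<⇒≤pred lo<v) ⟩
      suc (lookup v c ∸ 1) ∸ lookup lo c      ≡⟨ cong (_∸ lookup lo c) (suc-pred (lookup v c) {{>-nonZero (m<n⇒0<n lo<v)}}) ⟩
      lookup v c ∸ lookup lo c                ≡⟨ cong (_∸ lookup lo c) (lookup-v c) ⟩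
      lookup lo c + lookup x c ∸ lookup lo c  ≡⟨ m+n∸m≡n (lookup lo c) (lookup x c) ⟩
      lookup x c                              ∎
      where
      open ≡-Reasoning
      lo<v : lookup lo c < lookup v c
      lo<v = ≤-<-trans (≤ᵛ-lookup lo≤spine c) (down c a<v)

    side-after-rise : ∀ c → ℤ.+ lookup v c ℤ.< lookup a c →
                      suc (lookup hi' c ∸ lookup lo' c) ≡ lookup width c ∸ lookup x c
    side-after-rise c v<a = begin
      suc (lookup hi' c ∸ lookup lo' c)         ≡⟨ cong₂ (λ u l → suc (u ∸ l)) (trans (lookup-hi' c) (cut-stay (ℤₚ.<-asym v<a)))
                                                                        (trans (lookup-lo' c) (raise-up v<a)) ⟩
      suc (lookup hi c ∸ suc (lookup v c))      ≡⟨ suc-∸ (<-≤-trans (up c v<a) (≤ᵛ-lookup spine≤hi c)) ⟩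
      lookup hi c ∸ lookup v c                  ≡⟨ cong (lookup hi c ∸_) (lookup-v c) ⟩
      lookup hi c ∸ (lookup lo c + lookup x c)  ≡⟨ ∸-+-assoc (lookup hi c) (lookup lo c) (lookup x c) ⟨
      lookup hi c ∸ lookup lo c ∸ lookup x c    ≡⟨ cong (_∸ lookup x c) (lookup-width c) ⟨
      lookup width c ∸ lookup x c               ∎
      where open ≡-Reasoning

    halves-size : ∀ c {t} → suc (lookup hi' c ∸ lookup lo' c) ≡ t → t + t ≤ suc (lookup width c) →
                  size (lookup lo' c) (lookup hi' c) < size (lookup lo c) (lookup hi c)
    halves-size c side≡t t+t≤ = subst (λ z → ⌈log₂ z ⌉ < size (lookup lo c) (lookup hi c)) (sym side≡t)
      (⌈log₂⌉-halving (subst (1 ≤_) side≡t (s≤s z≤n)) (subst (λ w → _ ≤ suc w) (lookup-width c) t+t≤))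

    -- Some coordinate falls and some rises, and the balanced split halves the side of one of the two kinds.
    size-strict : ∃[ c ] size (lookup lo' c) (lookup hi' c) < size (lookup lo c) (lookup hi c)
    size-strict with balanced
    ... | inj₁ lower-half with c , ac<vc ← sumℤ≡∧≢⇒∃< (sym Σv≡Σa) a≢v =
      c , halves-size c (side-after-fall c (subst (lookup a c ℤ.<_) (lookup-toℤ c) ac<vc)) (lower-half c)
    ... | inj₂ upper-half with c , vc<ac ← sumℤ≡∧≢⇒∃< Σv≡Σa (a≢v ∘ sym) =
      c , halves-size c (side-after-rise c (subst (ℤ._< lookup a c) (lookup-toℤ c) vc<ac)) (upper-half c)

    potential-decreases : potential lo' hi' < potential lo hi
    potential-decreases with c , strict ← size-strict = <ᵛ⇒sum< {a = zipWith size lo' hi'} {b = zipWith size lo hi}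
      ( lookup⇒≤ᵛ (λ c' → subst₂ _≤_ (sym (lookup-size lo' hi' c')) (sym (lookup-size lo hi c')) (size-mono c'))
      , λ eq → <⇒≢ strict (trans (sym (lookup-size lo' hi' c))
                                  (trans (cong (λ t → lookup t c) eq) (lookup-size lo hi c))))
      where
      lookup-size : ∀ l u c' → lookup (zipWith size l u) c' ≡ size (lookup l c') (lookup u c')
      lookup-size l u c' = Vecₚ.lookup-zipWith size c' l u

  levelSearch-yields : ∀ f {ℓ lo hi} → Box ℓ lo hi → potential lo hi < f →
                       Yields h (levelSearch f ℓ lo hi) (Sound ℓ) (suc (potential lo hi))
  interpret-yields : ∀ f {ℓ lo hi} → Box ℓ lo hi → potential lo hi ≤ f → ∀ {a} → h (probe ℓ lo hi) ≡ a →
                     Yields h (interpret f ℓ lo hi (probe ℓ lo hi) a) (Sound ℓ) (potential lo hi)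

  levelSearch-yields (suc f) box (s≤s pot≤f) =
    yields-ask (interpret-yields f box pot≤f (cong h (sym (Probe.coords-v box))))

  interpret-yields f {ℓ} {lo} {hi} box pot≤f refl
    with Vecₚ.≡-dec ℤₚ._≟_ (h (probe ℓ lo hi)) (toℤ (probe ℓ lo hi))
  ... | yes hv≡v = yields-done (subst (λ u → h u ≡ toℤ u) (sym (Probe.coords-v box)) hv≡v)
  ... | no hv≢v with ℤₚ.<-cmp (ℤ.+ ℓ) (sumℤ (h (probe ℓ lo hi)))
  ...   | tri< ℓ<Σa _ _ = yields-done (Probe.level-below box ℓ<Σa)
  ...   | tri> _ _ Σa<ℓ = yields-done (Probe.level-above box Σa<ℓ)
  ...   | tri≈ _ ℓ≡Σa _ = yields-weaken potential-decreases
            (levelSearch-yields f box' (<-≤-trans potential-decreases pot≤f))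
    where open Shrink box hv≢v ℓ≡Σa using (box'; potential-decreases)

  initial-box : ∀ {ℓ} → ℓ ≤ L → Box ℓ bottom top
  initial-box ℓ≤L = record
    { ℓ≤L      = ℓ≤L
    ; lo≤spine = replicate-0-≤ᵛ (s _)
    ; spine≤hi = pt-≤-top ℓ≤L
    ; hi≤top   = ≤ᵛ-refl
    }

  initial-potential : potential bottom top ≡ k * ⌈log₂ suc m ⌉
  initial-potential = trans (cong sum (Vecₚ.zipWith-replicate {n = k} size 0 m)) (sum-replicate k (size 0 m))

  binarySearch-yields : ∀ f {α β} → α ≤ j → j ≤ β → β ≤ L → ⌈log₂ suc (β ∸ α) ⌉ < f →
                        Yields h (binarySearch f α β) Fixed (suc ⌈log₂ suc (β ∸ α) ⌉ * queriesPerLevel)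
  binarySearch-yields (suc f) {α} {β} α≤j j≤β β≤L (s≤s log<f) =
    yields->>= {B = queriesPerLevel}
      (subst (λ p → Yields h (levelSearch queriesPerLevel ℓ bottom top) (Sound ℓ) (suc p)) initial-potential
        (levelSearch-yields queriesPerLevel (initial-box ℓ≤L) (s≤s (≤-reflexive initial-potential))))
      next
    where
    ℓ : ℕ
    ℓ = midpoint α β
    ℓ≤L : ℓ ≤ L
    ℓ≤L = ≤-trans (midpoint-≤ (≤-trans α≤j j≤β)) β≤L
    recurse : ∀ {α' β'} → α' ≤ j → j ≤ β' → β' ≤ L → ⌈log₂ suc (β' ∸ α') ⌉ < ⌈log₂ suc (β ∸ α) ⌉ →
              Yields h (binarySearch f α' β') Fixed (⌈log₂ suc (β ∸ α) ⌉ * queriesPerLevel)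
    recurse α'≤j j≤β' β'≤L smaller = yields-weaken (*-monoˡ-≤ queriesPerLevel smaller)
      (binarySearch-yields f α'≤j j≤β' β'≤L (<-≤-trans smaller log<f))
    next : ∀ {r} → Sound ℓ r → Yields h (continue f α β r) Fixed (⌈log₂ suc (β ∸ α) ⌉ * queriesPerLevel)
    next {found p}  fixed = yields-done fixed
    next {raiseLevel} ℓ<j = recurse ℓ<j j≤β β≤L (upper-half-smaller {α} (<-≤-trans ℓ<j j≤β))
    next {lowerLevel} j<ℓ = recurse α≤j (<⇒≤pred j<ℓ) (≤-trans (m∸n≤m ℓ 1) ℓ≤L)
                                    (lower-half-smaller {β = β} (≤-<-trans α≤j j<ℓ))

  algorithm-finds : Fixed (proj₁ (run algorithm h)) × proj₂ (run algorithm h) ≤ suc ⌈log₂ suc L ⌉ * queriesPerLevel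
  algorithm-finds = subst (λ r → Fixed (proj₁ r) × proj₂ r ≤ suc ⌈log₂ suc L ⌉ * queriesPerLevel)
    (sym (run-toQueryAlg (binarySearch (suc ⌈log₂ suc L ⌉) 0 L) h))
    (Yields.result-ok search , Yields.cost≤ search)
    where
    search : Yields h (binarySearch (suc ⌈log₂ suc L ⌉) 0 L) Fixed (suc ⌈log₂ suc L ⌉ * queriesPerLevel)
    search = binarySearch-yields (suc ⌈log₂ suc L ⌉) z≤n j≤L ≤-refl ≤-refl

1≤⌈log₂⌉ : ∀ {n} → 2 ≤ n → 1 ≤ ⌈log₂ n ⌉
1≤⌈log₂⌉ {n} 2≤n = subst (_≤ ⌈log₂ n ⌉) (⌈log₂2^n⌉≡n 1) (⌈log₂⌉-mono-≤ 2≤n)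

suc≤2* : ∀ {x} → 1 ≤ x → suc x ≤ 2 * x
suc≤2* {x} 1≤x = subst (suc x ≤_) (cong (x +_) (sym (+-identityʳ x))) (+-monoˡ-≤ x 1≤x)

query-bound : ∀ {m k} → 1 ≤ m → 1 ≤ k →
  suc ⌈log₂ suc (m * k) ⌉ * suc (k * ⌈log₂ suc m ⌉) ≤ 4 * k * ⌈log₂ suc m ⌉ * ⌈log₂ (suc m * k) ⌉
query-bound {m} {k} 1≤m 1≤k = subst (suc ⌈log₂ suc (m * k) ⌉ * suc (k * A) ≤_) (rearrange B k A)
  (*-mono-≤ (≤-trans (s≤s (⌈log₂⌉-mono-≤ (+-monoˡ-≤ (m * k) 1≤k)))
                     (suc≤2* (1≤⌈log₂⌉ (*-mono-≤ (s≤s 1≤m) 1≤k))))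
            (suc≤2* (*-mono-≤ 1≤k (1≤⌈log₂⌉ (s≤s 1≤m)))))
  where
  A B : ℕ
  A = ⌈log₂ suc m ⌉
  B = ⌈log₂ (suc m * k) ⌉
  rearrange : ∀ B k A → 2 * B * (2 * (k * A)) ≡ 4 * k * A * B
  rearrange = ℕ-Solver.solve-∀

FindsFixedPoint : (n k : ℕ) → ℕ → QueryAlg n k → Set
FindsFixedPoint n k B A = (S : Spine n k) (j : ℕ) → j ≤ (n ∸ 1) * k →
  (herringbone S j (coords (proj₁ (run A (herringbone S j)))) ≡ toℤ (coords (proj₁ (run A (herringbone S j)))))
  × (proj₂ (run A (herringbone S j)) ≤ B)

finder-within : ∀ {n k B B'} (A : QueryAlg n k) → B ≤ B' → FindsFixedPoint n k B A →
                Σ (QueryAlg n k) (FindsFixedPoint n k B')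
finder-within A B≤B' finds = A , λ S j j≤L → Prod.map₂ (λ cost≤ → ≤-trans cost≤ B≤B') (finds S j j≤L)

single-point-finds : ∀ k → FindsFixedPoint 1 k 0 (output (replicate k fzero))
single-point-finds k S zero z≤n =
  subst (λ u → herringbone S 0 u ≡ toℤ u) (trans (start S) (sym (Vecₚ.map-replicate toℕ fzero k)))
        (HerringboneHints.herringbone-at-j S 0 z≤n)
  , z≤n

dimension-zero-finds : ∀ {n} → FindsFixedPoint n 0 0 (output [])
dimension-zero-finds S j _ = empty-unique _ _ , z≤n
  where
  empty-unique : (a b : Vec ℤ 0) → a ≡ b
  empty-unique [] [] = refl

algorithm-finds : ∀ m k →
  FindsFixedPoint (suc m) k (suc ⌈log₂ suc (m * k) ⌉ * suc (k * ⌈log₂ suc m ⌉)) (Algorithm.algorithm m k)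
algorithm-finds m k S j j≤L = Correctness.algorithm-finds S j j≤L

theorem2 : ∃[ C ] ((n k : ℕ) → 1 ≤ n →
    Σ (QueryAlg n k) λ A →
    (S : Spine n k) (j : ℕ) → j ≤ (n ∸ 1) * k →
    (herringbone S j (coords (proj₁ (run A (herringbone S j))))
    ≡ toℤᵛ S (coords (proj₁ (run A (herringbone S j)))))
    × (proj₂ (run A (herringbone S j))
    ≤ C * k * ⌈log₂ n ⌉ * ⌈log₂ (n * k) ⌉))
theorem2 = 4 , λ where
  1             k       _ → finder-within (output (replicate k fzero)) z≤n (single-point-finds k)
  (suc (suc m)) zero    _ → finder-within (output []) z≤n dimension-zero-finds
  (suc (suc m)) (suc k) _ → finder-within (Algorithm.algorithm (suc m) (suc k))
                              (query-bound {suc m} {suc k} (s≤s z≤n) (s≤s z≤n)) (algorithm-finds (suc m) (suc k))
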